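{- Let $h\ge1$ be an integer written as $h=2^\alpha h'$ with $h'$ odd. Then $$4\pi^2\big(\varphi_{\infty h}(1)+\varphi_{0h}(1)\big)=\frac{8\sigma_1(h')}{h}\,\big|2^{\alpha+1}-3\big|,$$ where $\varphi_{0h}(1)=\frac{\sigma^{(2)}_{ -1}(h)}{4\zeta^{(2)}(2)}$ and $\varphi_{\infty h}(1)=\frac{\frac14\sigma_{ -1}(h/4)-\frac18\sigma_{ -1}(h/2)}{\zeta^{(2)}(2)}$.
   Context: $\zeta^{(2)}(s)=(1-2^{ -s})\zeta(s)$; $\sigma_\nu(m)=\sum_{d\mid m}d^\nu$ for a positive integer $m$ and $\sigma_\nu(m)=0$ if $m$ is not a positive integer; $\sigma^{(2)}_\nu(m)$ is the sum of $d^\nu$ over the odd positive divisors $d$ of $m$. -}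

module Defs where

open import Data.Nat as ℕ using (ℕ; zero; suc; _^_)
open import Data.Nat.Divisibility using (_∣_; _∣?_)
open import Data.Integer as ℤ using (ℤ; +_)
open import Data.Rational as ℚ using (ℚ; 0ℚ; _+_; _*_; _-_; _/_)
open import Data.List using (List; []; _∷_; upTo; filter; map; foldr)
open import Relation.Nullary using (¬_; yes; no)
open import Relation.Nullary.Decidable using (¬?)

⟦_⟧ : ℕ → ℚ
⟦ n ⟧ = + n / 1

divisors : ℕ → List ℕ
divisors m = filter (λ d → d ∣? m) (map suc (upTo m))

oddDivisors : ℕ → List ℕ
oddDivisors m = filter (λ d → ¬? (2 ∣? d)) (divisors m)

sumℚ : List ℚ → ℚ
sumℚ = foldr _+_ 0ℚ

-- reciprocal of a natural number as a rational (d ↦ 1/d, with 1/0 := 0,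
-- which never occurs since divisors are ≥ 1)
recip : ℕ → ℚ
recip zero    = 0ℚ
recip (suc k) = + 1 / suc k

σ₁ : ℕ → ℕ
σ₁ m = foldr ℕ._+_ 0 (divisors m)

-- σ₋₁(m) = Σ_{d ∣ m} d⁻¹  (for positive integer m; equals 0 at m = 0)
σ₋₁ : ℕ → ℚ
σ₋₁ m = sumℚ (map recip (divisors m))

σ⁽²⁾₋₁ : ℕ → ℚ
σ⁽²⁾₋₁ m = sumℚ (map recip (oddDivisors m))

-- σ₋₁(h / k) for a rational argument h/k (k ≥ 1): σ₋₁ of the quotient if it is
-- a positive integer, and 0 otherwise (h/k not an integer, or h = 0)
σ₋₁[_/_] : ℕ → (k : ℕ) → .{{ℕ.NonZero k}} → ℚ
σ₋₁[ h / k ] with k ∣? h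
... | yes _ = σ₋₁ (h ℕ./ k)
... | no  _ = 0ℚ

-- ζ(2) / π² = 1/6 (Euler), hence ζ⁽²⁾(2) / π² = (1 - 2⁻²) ζ(2) / π².
ζ2/π² : ℚ
ζ2/π² = + 1 / 6

ζ⁽²⁾2/π² : ℚ
ζ⁽²⁾2/π² = (ℚ.1ℚ - + 1 / 4) * ζ2/π²

π²φ₀ : ℕ → ℚ
π²φ₀ h = σ⁽²⁾₋₁ h * ℚ.1/ (⟦ 4 ⟧ * ζ⁽²⁾2/π²)

π²φ∞ : ℕ → ℚ
π²φ∞ h = ((+ 1 / 4) * σ₋₁[ h / 4 ] - (+ 1 / 8) * σ₋₁[ h / 2 ]) * ℚ.1/ ζ⁽²⁾2/π²

{-# OPTIONS --safe #-}
-- Since ζ⁽²⁾(2)/π² = 1/8, the left-hand side is 8σ₋₁(h/4) − 4σ₋₁(h/2) + 8σ⁽²⁾₋₁(h).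
-- The odd divisors of 2^α h′ are exactly the divisors of h′, so σ⁽²⁾₋₁(h) = σ₋₁(h′), and
-- h′ σ₋₁(h′) = σ₁(h′) through d ↦ h′/d. Splitting the divisors of 2n into the odd ones and the
-- doubles of the divisors of n gives σ₋₁(2n) = σ⁽²⁾₋₁(2n) + σ₋₁(n)/2, hence
-- σ₋₁(2^k h′) = (2 − 2⁻ᵏ) σ₋₁(h′). Both sides are then σ₋₁(h′) times 8, 4 or 16 − 6·2^(2−α)
-- according as α = 0, α = 1 or α ≥ 2.
module Submission where

open import Defs
open import Data.Nat as ℕ using (ℕ; zero; suc; _≤_; _<_; _≤′_; _^_; z≤n; s≤s; NonZero)
import Data.Nat.Properties as ℕP
open import Data.Nat.Coprimality as Coprime using (Coprime; 1-coprimeTo; coprime-divisor)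
open import Data.Nat.Divisibility using (_∣_; _∣?_; divides; _∣0; ∣1⇒≡1; ∣m+n∣m⇒∣n; m∣m*n; ∣⇒≤; ∣-trans; *-cancelˡ-∣; *-monoʳ-∣)
open import Data.Nat.Primality using (irreducible[2])
open import Data.Nat.DivMod using (m*n/n≡m)
import Data.Integer as ℤ
import Data.Integer.Properties as ℤP
open import Data.Rational as ℚ using (ℚ; mkℚ; 0ℚ; 1ℚ; _+_; _*_; _-_; _/_; ∣_∣)
import Data.Rational.Properties as ℚP
open import Data.Rational.Solver using (module +-*-Solver)
open import Data.Nat.Tactic.RingSolver using (solve-∀)
open import Data.List using ([]; _∷_; _∷ʳ_; upTo; filter; map; foldr)
import Data.List.Properties as List
open import Data.Bool using (true; false; if_then_else_)
open import Data.Sum using (inj₁; inj₂)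
open import Data.Product using (_,_)
open import Function using (_∘_)
open import Level using (Level)
open import Relation.Nullary using (¬_; yes; no; does; contradiction)
open import Relation.Nullary.Decidable using (¬?)
open import Relation.Unary using (Pred; Decidable)
open import Relation.Binary.PropositionalEquality using (_≡_; refl; sym; trans; cong; cong₂; subst; module ≡-Reasoning)
open ≡-Reasoning
open +-*-Solver using (solve; _:+_; _:*_; _:-_; con; _:=_)

private variable
  p q : Level

⟦⟧-canonical : ∀ n → ⟦ n ⟧ ≡ mkℚ (ℤ.+ n) 0 (Coprime.sym (1-coprimeTo n))
⟦⟧-canonical n = ℚP.normalize-coprime (Coprime.sym (1-coprimeTo n))

⟦⟧-+ : ∀ m n → ⟦ m ℕ.+ n ⟧ ≡ ⟦ m ⟧ + ⟦ n ⟧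
⟦⟧-+ m n rewrite ⟦⟧-canonical m | ⟦⟧-canonical n =
  ℚP./-cong (sym (cong₂ ℤ._+_ (ℤP.*-identityʳ (ℤ.+ m)) (ℤP.*-identityʳ (ℤ.+ n)))) refl

⟦⟧-* : ∀ m n → ⟦ m ℕ.* n ⟧ ≡ ⟦ m ⟧ * ⟦ n ⟧
⟦⟧-* m n rewrite ⟦⟧-canonical m | ⟦⟧-canonical n = ℚP./-cong (ℤP.pos-* m n) refl

⟦⟧-∸ : ∀ {m n} → n ≤ m → ⟦ m ℕ.∸ n ⟧ ≡ ⟦ m ⟧ - ⟦ n ⟧
⟦⟧-∸ {m} {n} n≤m = begin
  ⟦ m ℕ.∸ n ⟧                     ≡⟨ solve 2 (λ x y → x := x :+ y :- y) refl ⟦ m ℕ.∸ n ⟧ ⟦ n ⟧ ⟩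
  ⟦ m ℕ.∸ n ⟧ + ⟦ n ⟧ - ⟦ n ⟧     ≡⟨ cong (_- ⟦ n ⟧) (sym (⟦⟧-+ (m ℕ.∸ n) n)) ⟩
  ⟦ m ℕ.∸ n ℕ.+ n ⟧ - ⟦ n ⟧       ≡⟨ cong (λ k → ⟦ k ⟧ - ⟦ n ⟧) (ℕP.m∸n+n≡m n≤m) ⟩
  ⟦ m ⟧ - ⟦ n ⟧                   ∎

∣⟦⟧∣ : ∀ n → ∣ ⟦ n ⟧ ∣ ≡ ⟦ n ⟧
∣⟦⟧∣ n rewrite ⟦⟧-canonical n = refl

∣⟦m⟧-⟦n⟧∣ : ∀ {m n} → n ≤ m → ∣ ⟦ m ⟧ - ⟦ n ⟧ ∣ ≡ ⟦ m ⟧ - ⟦ n ⟧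
∣⟦m⟧-⟦n⟧∣ {m} {n} n≤m = begin
  ∣ ⟦ m ⟧ - ⟦ n ⟧ ∣  ≡⟨ cong ∣_∣ (sym (⟦⟧-∸ n≤m)) ⟩
  ∣ ⟦ m ℕ.∸ n ⟧ ∣    ≡⟨ ∣⟦⟧∣ (m ℕ.∸ n) ⟩
  ⟦ m ℕ.∸ n ⟧        ≡⟨ ⟦⟧-∸ n≤m ⟩
  ⟦ m ⟧ - ⟦ n ⟧      ∎

recip-inverseˡ : ∀ n .{{_ : NonZero n}} → recip n * ⟦ n ⟧ ≡ 1ℚ
recip-inverseˡ n@(suc k) =
  trans (cong₂ _*_ (ℚP.normalize-coprime {1} {k} (1-coprimeTo n)) (⟦⟧-canonical n))
        (ℚP.*-inverseˡ (mkℚ (ℤ.+ n) 0 (Coprime.sym (1-coprimeTo n))))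

recip-inverseʳ : ∀ n .{{_ : NonZero n}} → ⟦ n ⟧ * recip n ≡ 1ℚ
recip-inverseʳ n = trans (ℚP.*-comm ⟦ n ⟧ (recip n)) (recip-inverseˡ n)

inverse-unique : ∀ {x y z} → x * z ≡ 1ℚ → y * z ≡ 1ℚ → x ≡ y
inverse-unique {x} {y} {z} xz≡1 yz≡1 = begin
  x             ≡⟨ sym (ℚP.*-identityʳ x) ⟩
  x * 1ℚ        ≡⟨ cong (x *_) (sym yz≡1) ⟩
  x * (y * z)   ≡⟨ solve 3 (λ x y z → x :* (y :* z) := y :* (x :* z)) refl x y z ⟩
  y * (x * z)   ≡⟨ cong (y *_) xz≡1 ⟩
  y * 1ℚ        ≡⟨ ℚP.*-identityʳ y ⟩
  y             ∎

recip-* : ∀ m n → recip (m ℕ.* n) ≡ recip m * recip n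
recip-* zero        n        = sym (ℚP.*-zeroˡ (recip n))
recip-* m@(suc _)   zero     = trans (cong recip (ℕP.*-zeroʳ m)) (sym (ℚP.*-zeroʳ (recip m)))
recip-* m@(suc _)   n@(suc _) = inverse-unique (recip-inverseˡ (m ℕ.* n)) (begin
  recip m * recip n * ⟦ m ℕ.* n ⟧          ≡⟨ cong (recip m * recip n *_) (⟦⟧-* m n) ⟩
  recip m * recip n * (⟦ m ⟧ * ⟦ n ⟧)      ≡⟨ solve 4 (λ a b c d → a :* b :* (c :* d) := (a :* c) :* (b :* d)) refl (recip m) (recip n) ⟦ m ⟧ ⟦ n ⟧ ⟩
  recip m * ⟦ m ⟧ * (recip n * ⟦ n ⟧)      ≡⟨ cong₂ _*_ (recip-inverseˡ m) (recip-inverseˡ n) ⟩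
  1ℚ                                       ∎)

⟦m*n⟧*recip-n : ∀ m n .{{_ : NonZero n}} → ⟦ m ℕ.* n ⟧ * recip n ≡ ⟦ m ⟧
⟦m*n⟧*recip-n m n = begin
  ⟦ m ℕ.* n ⟧ * recip n      ≡⟨ cong (_* recip n) (⟦⟧-* m n) ⟩
  ⟦ m ⟧ * ⟦ n ⟧ * recip n    ≡⟨ ℚP.*-assoc ⟦ m ⟧ ⟦ n ⟧ (recip n) ⟩
  ⟦ m ⟧ * (⟦ n ⟧ * recip n)  ≡⟨ cong (⟦ m ⟧ *_) (recip-inverseʳ n) ⟩
  ⟦ m ⟧ * 1ℚ                 ≡⟨ ℚP.*-identityʳ ⟦ m ⟧ ⟩
  ⟦ m ⟧                      ∎

restrict : {P : Pred ℕ p} → Decidable P → (ℕ → ℚ) → ℕ → ℚ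
restrict P? f x = if does (P? x) then f x else 0ℚ

module _ {P : Pred ℕ p} (P? : Decidable P) where

  restrict-yes : ∀ f x → P x → restrict P? f x ≡ f x
  restrict-yes f x px with P? x
  ... | yes _  = refl
  ... | no ¬px = contradiction px ¬px

  restrict-no : ∀ f x → ¬ P x → restrict P? f x ≡ 0ℚ
  restrict-no f x ¬px with P? x
  ... | yes px = contradiction px ¬px
  ... | no _   = refl

  restrict-zero : ∀ f x → f x ≡ 0ℚ → restrict P? f x ≡ 0ℚ
  restrict-zero f x fx≡0 with P? x
  ... | yes _ = fx≡0
  ... | no _  = refl

  restrict-* : ∀ c f x → restrict P? (λ y → c * f y) x ≡ c * restrict P? f x
  restrict-* c f x with P? x
  ... | yes _ = refl
  ... | no _  = sym (ℚP.*-zeroʳ c)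

  restrict-cong : ∀ {Q : Pred ℕ q} (Q? : Decidable Q) f g x y →
                  (P x → Q y) → (Q y → P x) → (P x → f x ≡ g y) →
                  restrict P? f x ≡ restrict Q? g y
  restrict-cong Q? f g x y P⇒Q Q⇒P fx≡gy with P? x | Q? y
  ... | yes px  | yes _   = fx≡gy px
  ... | yes px  | no ¬qy  = contradiction (P⇒Q px) ¬qy
  ... | no ¬px  | yes qy  = contradiction (Q⇒P qy) ¬px
  ... | no _    | no _    = refl

  restrict-split : ∀ {Q : Pred ℕ q} (Q? : Decidable Q) f x →
                   restrict P? f x ≡ restrict P? (restrict (¬? ∘ Q?) f) x + restrict P? (restrict Q? f) x
  restrict-split Q? f x with P? x | Q? x
  ... | yes _ | yes _ = sym (ℚP.+-identityˡ (f x))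
  ... | yes _ | no _  = sym (ℚP.+-identityʳ (f x))
  ... | no _  | _     = refl

∑ : ℕ → (ℕ → ℚ) → ℚ
∑ zero    f = 0ℚ
∑ (suc n) f = ∑ n f + f (suc n)

∑-cong : ∀ n {f g} → (∀ d → 1 ≤ d → d ≤ n → f d ≡ g d) → ∑ n f ≡ ∑ n g
∑-cong zero    f≗g = refl
∑-cong (suc n) f≗g = cong₂ _+_ (∑-cong n λ d 1≤d d≤n → f≗g d 1≤d (ℕP.m≤n⇒m≤1+n d≤n))
                               (f≗g (suc n) (s≤s z≤n) ℕP.≤-refl)

∑-zero : ∀ n {f} → (∀ d → 1 ≤ d → d ≤ n → f d ≡ 0ℚ) → ∑ n f ≡ 0ℚ
∑-zero zero    f≗0 = refl
∑-zero (suc n) f≗0 = trans (cong₂ _+_ (∑-zero n λ d 1≤d d≤n → f≗0 d 1≤d (ℕP.m≤n⇒m≤1+n d≤n))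
                                      (f≗0 (suc n) (s≤s z≤n) ℕP.≤-refl))
                           (ℚP.+-identityʳ 0ℚ)

∑-+ : ∀ n f g → ∑ n (λ d → f d + g d) ≡ ∑ n f + ∑ n g
∑-+ zero    f g = refl
∑-+ (suc n) f g = trans (cong (_+ (f (suc n) + g (suc n))) (∑-+ n f g))
  (solve 4 (λ a b c d → (a :+ b) :+ (c :+ d) := (a :+ c) :+ (b :+ d)) refl
     (∑ n f) (∑ n g) (f (suc n)) (g (suc n)))

∑-* : ∀ n c f → ∑ n (λ d → c * f d) ≡ c * ∑ n f
∑-* zero    c f = sym (ℚP.*-zeroʳ c)
∑-* (suc n) c f = trans (cong (_+ c * f (suc n)) (∑-* n c f))
                        (sym (ℚP.*-distribˡ-+ c (∑ n f) (f (suc n))))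

∑-comm : ∀ m n (f : ℕ → ℕ → ℚ) → ∑ m (λ i → ∑ n (f i)) ≡ ∑ n (λ j → ∑ m (λ i → f i j))
∑-comm zero    n f = sym (∑-zero n λ _ _ _ → refl)
∑-comm (suc m) n f = trans (cong (_+ ∑ n (f (suc m))) (∑-comm m n f))
                           (sym (∑-+ n (λ j → ∑ m (λ i → f i j)) (f (suc m))))

∑-tail-zero : ∀ {n m f} → n ≤ m → (∀ d → n < d → d ≤ m → f d ≡ 0ℚ) → ∑ m f ≡ ∑ n f
∑-tail-zero n≤m = go (ℕP.≤⇒≤′ n≤m)
  where
  go : ∀ {n m f} → n ≤′ m → (∀ d → n < d → d ≤ m → f d ≡ 0ℚ) → ∑ m f ≡ ∑ n f
  go ℕ.≤′-refl         _     = refl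
  go {n} {suc m} {f} (ℕ.≤′-step n≤′m) f≗0 = begin
    ∑ m f + f (suc m)  ≡⟨ cong₂ _+_ (go n≤′m λ d n<d d≤m → f≗0 d n<d (ℕP.m≤n⇒m≤1+n d≤m))
                                    (f≗0 (suc m) (s≤s (ℕP.≤′⇒≤ n≤′m)) ℕP.≤-refl) ⟩
    ∑ n f + 0ℚ         ≡⟨ ℚP.+-identityʳ (∑ n f) ⟩
    ∑ n f              ∎

2∤1+2*n : ∀ n → ¬ 2 ∣ suc (2 ℕ.* n)
2∤1+2*n n 2∣1+2n = contradiction (∣1⇒≡1 (∣m+n∣m⇒∣n 2∣2n+1 (m∣m*n n))) λ ()
  where
  2∣2n+1 : 2 ∣ 2 ℕ.* n ℕ.+ 1
  2∣2n+1 = subst (2 ∣_) (ℕP.+-comm 1 (2 ℕ.* n)) 2∣1+2n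

∑-2* : ∀ n {f} → (∀ d → ¬ 2 ∣ d → f d ≡ 0ℚ) → ∑ (2 ℕ.* n) f ≡ ∑ n (λ j → f (2 ℕ.* j))
∑-2* zero    _    = refl
∑-2* (suc n) {f} odd⇒0 = begin
  ∑ (2 ℕ.* suc n) f                                 ≡⟨ cong (λ k → ∑ k f) (ℕP.*-suc 2 n) ⟩
  ∑ (2 ℕ.* n) f + f (suc (2 ℕ.* n)) + f (2 ℕ.+ 2 ℕ.* n)
    ≡⟨ cong₂ (λ a b → a + b + f (2 ℕ.+ 2 ℕ.* n)) (∑-2* n odd⇒0) (odd⇒0 (suc (2 ℕ.* n)) (2∤1+2*n n)) ⟩
  ∑ n (λ j → f (2 ℕ.* j)) + 0ℚ + f (2 ℕ.+ 2 ℕ.* n)  ≡⟨ cong (_+ f (2 ℕ.+ 2 ℕ.* n)) (ℚP.+-identityʳ (∑ n (λ j → f (2 ℕ.* j)))) ⟩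
  ∑ n (λ j → f (2 ℕ.* j)) + f (2 ℕ.+ 2 ℕ.* n)       ≡⟨ cong (λ k → ∑ n (λ j → f (2 ℕ.* j)) + f k) (sym (ℕP.*-suc 2 n)) ⟩
  ∑ (suc n) (λ j → f (2 ℕ.* j))                     ∎

∑-restrict-unique : ∀ {P : Pred ℕ p} (P? : Decidable P) f {c} n → 1 ≤ c → c ≤ n →
                    P c → (∀ d → P d → d ≡ c) → ∑ n (restrict P? f) ≡ f c
∑-restrict-unique P? f zero 1≤c c≤0 _ _ = contradiction c≤0 (ℕP.<⇒≱ 1≤c)
∑-restrict-unique P? f {c} (suc n) 1≤c c≤1+n pc unique with ℕP.m≤n⇒m<n∨m≡n c≤1+n
... | inj₁ c<1+n = begin
  ∑ n (restrict P? f) + restrict P? f (suc n)  ≡⟨ cong₂ _+_ (∑-restrict-unique P? f n 1≤c (ℕP.≤-pred c<1+n) pc unique)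
                                                          (restrict-no P? f (suc n) λ p → ℕP.<⇒≢ c<1+n (sym (unique (suc n) p))) ⟩
  f c + 0ℚ                                     ≡⟨ ℚP.+-identityʳ (f c) ⟩
  f c                                          ∎
... | inj₂ refl = begin
  ∑ n (restrict P? f) + restrict P? f (suc n)  ≡⟨ cong₂ _+_ (∑-zero n λ d _ d≤n → restrict-no P? f d λ p → ℕP.<⇒≢ (s≤s d≤n) (unique d p))
                                                          (restrict-yes P? f (suc n) pc) ⟩
  0ℚ + f (suc n)                               ≡⟨ ℚP.+-identityˡ (f (suc n)) ⟩
  f (suc n)                                    ∎

sumℚ-∷ʳ : ∀ xs x → sumℚ (xs ∷ʳ x) ≡ sumℚ xs + x
sumℚ-∷ʳ []       x = trans (ℚP.+-identityʳ x) (sym (ℚP.+-identityˡ x))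
sumℚ-∷ʳ (y ∷ xs) x = trans (cong (y +_) (sumℚ-∷ʳ xs x)) (sym (ℚP.+-assoc y (sumℚ xs) x))

sumℚ-filter : ∀ {P : Pred ℕ p} (P? : Decidable P) f xs →
              sumℚ (map f (filter P? xs)) ≡ sumℚ (map (restrict P? f) xs)
sumℚ-filter P? f []       = refl
sumℚ-filter P? f (x ∷ xs) with does (P? x)
... | true  = cong (f x +_) (sumℚ-filter P? f xs)
... | false = trans (sumℚ-filter P? f xs) (sym (ℚP.+-identityˡ _))

sumℚ-[1‥n] : ∀ n f → sumℚ (map f (map suc (upTo n))) ≡ ∑ n f
sumℚ-[1‥n] zero    f = refl
sumℚ-[1‥n] (suc n) f = begin
  sumℚ (map f (map suc (upTo (suc n))))         ≡⟨ cong (sumℚ ∘ map f ∘ map suc) (sym (List.upTo-∷ʳ n)) ⟩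
  sumℚ (map f (map suc (upTo n ∷ʳ n)))          ≡⟨ cong (sumℚ ∘ map f) (List.map-++ suc (upTo n) (n ∷ [])) ⟩
  sumℚ (map f (map suc (upTo n) ∷ʳ suc n))      ≡⟨ cong sumℚ (List.map-++ f (map suc (upTo n)) (suc n ∷ [])) ⟩
  sumℚ (map f (map suc (upTo n)) ∷ʳ f (suc n))  ≡⟨ sumℚ-∷ʳ (map f (map suc (upTo n))) (f (suc n)) ⟩
  sumℚ (map f (map suc (upTo n))) + f (suc n)   ≡⟨ cong (_+ f (suc n)) (sumℚ-[1‥n] n f) ⟩
  ∑ (suc n) f                                   ∎

odd? : Decidable (λ d → ¬ 2 ∣ d)
odd? d = ¬? (2 ∣? d)

σ₋₁-∑ : ∀ m → σ₋₁ m ≡ ∑ m (restrict (_∣? m) recip)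
σ₋₁-∑ m = trans (sumℚ-filter (_∣? m) recip (map suc (upTo m))) (sumℚ-[1‥n] m _)

σ⁽²⁾₋₁-∑ : ∀ m → σ⁽²⁾₋₁ m ≡ ∑ m (restrict (_∣? m) (restrict odd? recip))
σ⁽²⁾₋₁-∑ m = begin
  σ⁽²⁾₋₁ m                                                 ≡⟨ sumℚ-filter odd? recip (divisors m) ⟩
  sumℚ (map (restrict odd? recip) (divisors m))            ≡⟨ sumℚ-filter (_∣? m) (restrict odd? recip) (map suc (upTo m)) ⟩
  sumℚ (map (restrict (_∣? m) (restrict odd? recip)) (map suc (upTo m)))
                                                           ≡⟨ sumℚ-[1‥n] m (restrict (_∣? m) (restrict odd? recip)) ⟩
  ∑ m (restrict (_∣? m) (restrict odd? recip))             ∎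

⟦sum⟧ : ∀ xs → ⟦ foldr ℕ._+_ 0 xs ⟧ ≡ sumℚ (map ⟦_⟧ xs)
⟦sum⟧ []       = refl
⟦sum⟧ (x ∷ xs) = trans (⟦⟧-+ x _) (cong (⟦ x ⟧ +_) (⟦sum⟧ xs))

⟦σ₁⟧-∑ : ∀ m → ⟦ σ₁ m ⟧ ≡ ∑ m (restrict (_∣? m) ⟦_⟧)
⟦σ₁⟧-∑ m = begin
  ⟦ σ₁ m ⟧                       ≡⟨ ⟦sum⟧ (divisors m) ⟩
  sumℚ (map ⟦_⟧ (divisors m))    ≡⟨ sumℚ-filter (_∣? m) ⟦_⟧ (map suc (upTo m)) ⟩
  sumℚ (map (restrict (_∣? m) ⟦_⟧) (map suc (upTo m)))
                                 ≡⟨ sumℚ-[1‥n] m (restrict (_∣? m) ⟦_⟧) ⟩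
  ∑ m (restrict (_∣? m) ⟦_⟧)     ∎

⟦σ₁⟧≡⟦n⟧*σ₋₁ : ∀ n → ⟦ σ₁ n ⟧ ≡ ⟦ n ⟧ * σ₋₁ n
⟦σ₁⟧≡⟦n⟧*σ₋₁ zero      = refl
⟦σ₁⟧≡⟦n⟧*σ₋₁ n@(suc _) = begin
  ⟦ σ₁ n ⟧                                    ≡⟨ ⟦σ₁⟧-∑ n ⟩
  ∑ n (restrict (_∣? n) ⟦_⟧)                  ≡⟨ ∑-cong n (λ e 1≤e _ → sym (column e 1≤e)) ⟩
  ∑ n (λ e → ∑ n (λ d → K d e))               ≡⟨ ∑-comm n n (λ e d → K d e) ⟩
  ∑ n (λ d → ∑ n (K d))                       ≡⟨ ∑-cong n (λ d 1≤d _ → row d 1≤d) ⟩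
  ∑ n (λ d → ⟦ n ⟧ * restrict (_∣? n) recip d) ≡⟨ ∑-* n ⟦ n ⟧ _ ⟩
  ⟦ n ⟧ * ∑ n (restrict (_∣? n) recip)        ≡⟨ cong (⟦ n ⟧ *_) (sym (σ₋₁-∑ n)) ⟩
  ⟦ n ⟧ * σ₋₁ n                               ∎
  where
  -- As a function of d, K d e is definitionally restrict (λ d → d * e ≟ n) (λ _ → ⟦ e ⟧),
  -- which is how column sees it.
  K : ℕ → ℕ → ℚ
  K d = restrict (λ e → d ℕ.* e ℕ.≟ n) ⟦_⟧

  row : ∀ d → 1 ≤ d → ∑ n (K d) ≡ ⟦ n ⟧ * restrict (_∣? n) recip d
  row d@(suc _) _ with d ∣? n
  ... | yes d∣n@(divides q@(suc _) n≡q*d) = begin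
    ∑ n (K d)                         ≡⟨ ∑-restrict-unique (λ e → d ℕ.* e ℕ.≟ n) ⟦_⟧ n (s≤s z≤n) q≤n d*q≡n
                                           (λ e d*e≡n → ℕP.*-cancelˡ-≡ e q d (trans d*e≡n (sym d*q≡n))) ⟩
    ⟦ q ⟧                             ≡⟨ sym (⟦m*n⟧*recip-n q d) ⟩
    ⟦ q ℕ.* d ⟧ * recip d             ≡⟨ cong (λ k → ⟦ k ⟧ * recip d) (sym n≡q*d) ⟩
    ⟦ n ⟧ * recip d                   ≡⟨ cong (⟦ n ⟧ *_) (sym (restrict-yes (_∣? n) recip d d∣n)) ⟩
    ⟦ n ⟧ * restrict (_∣? n) recip d  ∎
    where
    d*q≡n : d ℕ.* q ≡ n
    d*q≡n = trans (ℕP.*-comm d q) (sym n≡q*d)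
    q≤n : q ≤ n
    q≤n = subst (q ≤_) (sym n≡q*d) (ℕP.m≤m*n q d)
  ... | no d∤n = begin
    ∑ n (K d)                         ≡⟨ ∑-zero n (λ e _ _ → restrict-no (λ e → d ℕ.* e ℕ.≟ n) ⟦_⟧ e λ d*e≡n →
                                                       d∤n (divides e (trans (sym d*e≡n) (ℕP.*-comm d e)))) ⟩
    0ℚ                                ≡⟨ sym (ℚP.*-zeroʳ ⟦ n ⟧) ⟩
    ⟦ n ⟧ * 0ℚ                        ≡⟨ cong (⟦ n ⟧ *_) (sym (restrict-no (_∣? n) recip d d∤n)) ⟩
    ⟦ n ⟧ * restrict (_∣? n) recip d  ∎

  column : ∀ e → 1 ≤ e → ∑ n (λ d → K d e) ≡ restrict (_∣? n) ⟦_⟧ e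
  column e@(suc _) _ with e ∣? n
  ... | yes e∣n@(divides q@(suc _) n≡q*e) = trans
    (∑-restrict-unique (λ d → d ℕ.* e ℕ.≟ n) (λ _ → ⟦ e ⟧) n (s≤s z≤n) q≤n (sym n≡q*e)
       (λ d d*e≡n → ℕP.*-cancelʳ-≡ d q e (trans d*e≡n n≡q*e)))
    (sym (restrict-yes (_∣? n) ⟦_⟧ e e∣n))
    where
    q≤n : q ≤ n
    q≤n = subst (q ≤_) (sym n≡q*e) (ℕP.m≤m*n q e)
  ... | no e∤n = trans
    (∑-zero n (λ d _ _ → restrict-no (λ d → d ℕ.* e ℕ.≟ n) (λ _ → ⟦ e ⟧) d λ d*e≡n → e∤n (divides d (sym d*e≡n))))
    (sym (restrict-no (_∣? n) ⟦_⟧ e e∤n))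

odd⇒coprime-2 : ∀ {d} → ¬ 2 ∣ d → Coprime d 2
odd⇒coprime-2 2∤d (i∣d , i∣2) with irreducible[2] i∣2
... | inj₁ i≡1 = i≡1
... | inj₂ refl = contradiction i∣d 2∤d

odd∣2^k*n⇒∣n : ∀ k {d n} → ¬ 2 ∣ d → d ∣ 2 ^ k ℕ.* n → d ∣ n
odd∣2^k*n⇒∣n zero    {d} {n} _   d∣1*n = subst (d ∣_) (ℕP.*-identityˡ n) d∣1*n
odd∣2^k*n⇒∣n (suc k) {d} {n} 2∤d d∣2*2^k*n = odd∣2^k*n⇒∣n k 2∤d
  (coprime-divisor (odd⇒coprime-2 2∤d) (subst (d ∣_) (ℕP.*-assoc 2 (2 ^ k) n) d∣2*2^k*n))

σ⁽²⁾₋₁[2^k*n] : ∀ k {n} → ¬ 2 ∣ n → σ⁽²⁾₋₁ (2 ^ k ℕ.* n) ≡ σ₋₁ n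
σ⁽²⁾₋₁[2^k*n] k {n} 2∤n = begin
  σ⁽²⁾₋₁ M                                      ≡⟨ σ⁽²⁾₋₁-∑ M ⟩
  ∑ M (restrict (_∣? M) (restrict odd? recip))  ≡⟨ ∑-tail-zero n≤M (λ d n<d _ → beyond-n d n<d) ⟩
  ∑ n (restrict (_∣? M) (restrict odd? recip))  ≡⟨ ∑-cong n (λ d _ _ → same d) ⟩
  ∑ n (restrict (_∣? n) recip)                  ≡⟨ sym (σ₋₁-∑ n) ⟩
  σ₋₁ n                                         ∎
  where
  M = 2 ^ k ℕ.* n
  instance
    _ = ℕP.m^n≢0 2 k
    n-nonZero : NonZero n
    n-nonZero = ℕ.≢-nonZero λ { refl → 2∤n (2 ∣0) }
  n≤M : n ≤ M
  n≤M = ℕP.m≤n*m n (2 ^ k)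
  beyond-n : ∀ d → n < d → restrict (_∣? M) (restrict odd? recip) d ≡ 0ℚ
  beyond-n d n<d with 2 ∣? d
  ... | yes 2∣d = restrict-zero (_∣? M) (restrict odd? recip) d (restrict-no odd? recip d λ 2∤d → 2∤d 2∣d)
  ... | no 2∤d  = restrict-no (_∣? M) (restrict odd? recip) d λ d∣M →
                    ℕP.<⇒≱ n<d (∣⇒≤ (odd∣2^k*n⇒∣n k 2∤d d∣M))
  same : ∀ d → restrict (_∣? M) (restrict odd? recip) d ≡ restrict (_∣? n) recip d
  same d with 2 ∣? d
  ... | yes 2∣d = trans (restrict-zero (_∣? M) (restrict odd? recip) d (restrict-no odd? recip d λ 2∤d → 2∤d 2∣d))
                        (sym (restrict-no (_∣? n) recip d λ d∣n → 2∤n (∣-trans 2∣d d∣n)))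
  ... | no 2∤d  = restrict-cong (_∣? M) (_∣? n) (restrict odd? recip) recip d d
                    (odd∣2^k*n⇒∣n k 2∤d) (λ d∣n → ∣-trans d∣n (divides (2 ^ k) refl))
                    (λ _ → restrict-yes odd? recip d 2∤d)

σ₋₁[2*n] : ∀ n → σ₋₁ (2 ℕ.* n) ≡ σ⁽²⁾₋₁ (2 ℕ.* n) + recip 2 * σ₋₁ n
σ₋₁[2*n] n = begin
  σ₋₁ N                                              ≡⟨ σ₋₁-∑ N ⟩
  ∑ N (restrict (_∣? N) recip)                       ≡⟨ ∑-cong N (λ d _ _ → restrict-split (_∣? N) (2 ∣?_) recip d) ⟩
  ∑ N (λ d → odd-part d + even-part d)               ≡⟨ ∑-+ N odd-part even-part ⟩
  ∑ N odd-part + ∑ N even-part                       ≡⟨ cong₂ _+_ (sym (σ⁽²⁾₋₁-∑ N)) (∑-2* n odd⇒even-part≡0) ⟩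
  σ⁽²⁾₋₁ N + ∑ n (λ j → even-part (2 ℕ.* j))         ≡⟨ cong (σ⁽²⁾₋₁ N +_) (∑-cong n (λ j _ _ → even-part[2*j] j)) ⟩
  σ⁽²⁾₋₁ N + ∑ n (λ j → recip 2 * restrict (_∣? n) recip j)  ≡⟨ cong (σ⁽²⁾₋₁ N +_) (∑-* n (recip 2) _) ⟩
  σ⁽²⁾₋₁ N + recip 2 * ∑ n (restrict (_∣? n) recip)  ≡⟨ cong (λ s → σ⁽²⁾₋₁ N + recip 2 * s) (sym (σ₋₁-∑ n)) ⟩
  σ⁽²⁾₋₁ N + recip 2 * σ₋₁ n                         ∎
  where
  N = 2 ℕ.* n
  odd-part even-part : ℕ → ℚ
  odd-part  = restrict (_∣? N) (restrict odd? recip)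
  even-part = restrict (_∣? N) (restrict (2 ∣?_) recip)
  odd⇒even-part≡0 : ∀ d → ¬ 2 ∣ d → even-part d ≡ 0ℚ
  odd⇒even-part≡0 d 2∤d = restrict-zero (_∣? N) (restrict (2 ∣?_) recip) d (restrict-no (2 ∣?_) recip d 2∤d)
  even-part[2*j] : ∀ j → even-part (2 ℕ.* j) ≡ recip 2 * restrict (_∣? n) recip j
  even-part[2*j] j = trans
    (restrict-cong (_∣? N) (_∣? n) (restrict (2 ∣?_) recip) (λ i → recip 2 * recip i) (2 ℕ.* j) j
       (*-cancelˡ-∣ 2) (*-monoʳ-∣ 2)
       (λ _ → trans (restrict-yes (2 ∣?_) recip (2 ℕ.* j) (m∣m*n j)) (recip-* 2 j)))
    (restrict-* (_∣? n) (recip 2) recip j)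

σ₋₁[2^k*n] : ∀ k {n} → ¬ 2 ∣ n → σ₋₁ (2 ^ k ℕ.* n) ≡ (⟦ 2 ⟧ - recip (2 ^ k)) * σ₋₁ n
σ₋₁[2^k*n] zero    {n} _   = trans (cong σ₋₁ (ℕP.*-identityˡ n))
                                   (solve 1 (λ X → X := (con ⟦ 2 ⟧ :- con 1ℚ) :* X) refl (σ₋₁ n))
σ₋₁[2^k*n] (suc k) {n} 2∤n = begin
  σ₋₁ (2 ^ suc k ℕ.* n)                               ≡⟨ cong σ₋₁ (ℕP.*-assoc 2 (2 ^ k) n) ⟩
  σ₋₁ (2 ℕ.* M)                                       ≡⟨ σ₋₁[2*n] M ⟩
  σ⁽²⁾₋₁ (2 ℕ.* M) + recip 2 * σ₋₁ M                  ≡⟨ cong₂ (λ a b → a + recip 2 * b) σ⁽²⁾₋₁[2*M] (σ₋₁[2^k*n] k 2∤n) ⟩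
  σ₋₁ n + recip 2 * ((⟦ 2 ⟧ - recip (2 ^ k)) * σ₋₁ n) ≡⟨ solve 2 (λ X r → X :+ con (recip 2) :* ((con ⟦ 2 ⟧ :- r) :* X)
                                                                  := (con ⟦ 2 ⟧ :- con (recip 2) :* r) :* X) refl (σ₋₁ n) (recip (2 ^ k)) ⟩
  (⟦ 2 ⟧ - recip 2 * recip (2 ^ k)) * σ₋₁ n          ≡⟨ cong (λ r → (⟦ 2 ⟧ - r) * σ₋₁ n) (sym (recip-* 2 (2 ^ k))) ⟩
  (⟦ 2 ⟧ - recip (2 ^ suc k)) * σ₋₁ n                 ∎
  where
  M = 2 ^ k ℕ.* n
  σ⁽²⁾₋₁[2*M] : σ⁽²⁾₋₁ (2 ℕ.* M) ≡ σ₋₁ n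
  σ⁽²⁾₋₁[2*M] = trans (cong σ⁽²⁾₋₁ (sym (ℕP.*-assoc 2 (2 ^ k) n))) (σ⁽²⁾₋₁[2^k*n] (suc k) 2∤n)

σ₋₁[q*k/k] : ∀ {h} k .{{_ : NonZero k}} q → h ≡ q ℕ.* k → σ₋₁[ h / k ] ≡ σ₋₁ q
σ₋₁[q*k/k] {h} k q h≡q*k with k ∣? h
... | yes _   = cong σ₋₁ (trans (cong (ℕ._/ k) h≡q*k) (m*n/n≡m q k))
... | no k∤h  = contradiction (divides q h≡q*k) k∤h

σ₋₁[h/k]≡0 : ∀ {h} k .{{_ : NonZero k}} → ¬ k ∣ h → σ₋₁[ h / k ] ≡ 0ℚ
σ₋₁[h/k]≡0 {h} k k∤h with k ∣? h
... | yes k∣h = contradiction k∣h k∤h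
... | no _    = refl

-- The factors 1/(ζ⁽²⁾(2)/π²) and 1/(4 ζ⁽²⁾(2)/π²) compute to 8 and 2.
4[π²φ∞+π²φ₀] : ∀ h → ⟦ 4 ⟧ * (π²φ∞ h + π²φ₀ h) ≡ ⟦ 8 ⟧ * σ₋₁[ h / 4 ] - ⟦ 4 ⟧ * σ₋₁[ h / 2 ] + ⟦ 8 ⟧ * σ⁽²⁾₋₁ h
4[π²φ∞+π²φ₀] h = solve 3
  (λ A B X → con ⟦ 4 ⟧ :* ((con (ℤ.+ 1 / 4) :* A :- con (ℤ.+ 1 / 8) :* B) :* con ⟦ 8 ⟧ :+ X :* con ⟦ 2 ⟧)
           := con ⟦ 8 ⟧ :* A :- con ⟦ 4 ⟧ :* B :+ con ⟦ 8 ⟧ :* X)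
  refl σ₋₁[ h / 4 ] σ₋₁[ h / 2 ] (σ⁽²⁾₋₁ h)

⟦c*σ₁n⟧*recip[j*n] : ∀ c j n .{{_ : NonZero n}} → ⟦ c ℕ.* σ₁ n ⟧ * recip (j ℕ.* n) ≡ ⟦ c ⟧ * recip j * σ₋₁ n
⟦c*σ₁n⟧*recip[j*n] c j n = begin
  ⟦ c ℕ.* σ₁ n ⟧ * recip (j ℕ.* n)             ≡⟨ cong₂ _*_ (trans (⟦⟧-* c (σ₁ n)) (cong (⟦ c ⟧ *_) (⟦σ₁⟧≡⟦n⟧*σ₋₁ n))) (recip-* j n) ⟩
  ⟦ c ⟧ * (⟦ n ⟧ * σ₋₁ n) * (recip j * recip n) ≡⟨ solve 5 (λ C N X R S → C :* (N :* X) :* (R :* S) := C :* R :* X :* (N :* S)) refl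
                                                     ⟦ c ⟧ ⟦ n ⟧ (σ₋₁ n) (recip j) (recip n) ⟩
  ⟦ c ⟧ * recip j * σ₋₁ n * (⟦ n ⟧ * recip n)   ≡⟨ cong (⟦ c ⟧ * recip j * σ₋₁ n *_) (recip-inverseʳ n) ⟩
  ⟦ c ⟧ * recip j * σ₋₁ n * 1ℚ                  ≡⟨ ℚP.*-identityʳ _ ⟩
  ⟦ c ⟧ * recip j * σ₋₁ n                       ∎

∣⟦2^[k+3]⟧-⟦3⟧∣ : ∀ k → ∣ ⟦ 2 ^ (suc (suc k) ℕ.+ 1) ⟧ - ⟦ 3 ⟧ ∣ ≡ ⟦ 8 ⟧ * ⟦ 2 ^ k ⟧ - ⟦ 3 ⟧
∣⟦2^[k+3]⟧-⟦3⟧∣ k = begin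
  ∣ ⟦ 2 ^ (2 ℕ.+ k ℕ.+ 1) ⟧ - ⟦ 3 ⟧ ∣  ≡⟨ ∣⟦m⟧-⟦n⟧∣ 3≤2^[k+3] ⟩
  ⟦ 2 ^ (2 ℕ.+ k ℕ.+ 1) ⟧ - ⟦ 3 ⟧      ≡⟨ cong (λ e → ⟦ e ⟧ - ⟦ 3 ⟧) 2^[k+3]≡8*2^k ⟩
  ⟦ 8 ℕ.* 2 ^ k ⟧ - ⟦ 3 ⟧              ≡⟨ cong (_- ⟦ 3 ⟧) (⟦⟧-* 8 (2 ^ k)) ⟩
  ⟦ 8 ⟧ * ⟦ 2 ^ k ⟧ - ⟦ 3 ⟧            ∎
  where
  instance _ = ℕP.m^n≢0 2 k
  2^[k+3]≡8*2^k : 2 ^ (2 ℕ.+ k ℕ.+ 1) ≡ 8 ℕ.* 2 ^ k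
  2^[k+3]≡8*2^k = trans (cong (2 ^_) (ℕP.+-comm (2 ℕ.+ k) 1)) (ℕP.^-distribˡ-+-* 2 3 k)
  3≤2^[k+3] : 3 ≤ 2 ^ (2 ℕ.+ k ℕ.+ 1)
  3≤2^[k+3] = subst (3 ≤_) (sym 2^[k+3]≡8*2^k) (ℕP.≤-trans (s≤s (s≤s (s≤s z≤n))) (ℕP.m≤m*n 8 (2 ^ k)))

8σ₋₁[2^α*n/4]-4σ₋₁[2^α*n/2]+8σ₋₁[n] : ∀ α {n} → ¬ 2 ∣ n →
  ⟦ 8 ⟧ * σ₋₁[ 2 ^ α ℕ.* n / 4 ] - ⟦ 4 ⟧ * σ₋₁[ 2 ^ α ℕ.* n / 2 ] + ⟦ 8 ⟧ * σ₋₁ n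
    ≡ ⟦ 8 ⟧ * recip (2 ^ α) * σ₋₁ n * ∣ ⟦ 2 ^ (α ℕ.+ 1) ⟧ - ⟦ 3 ⟧ ∣
8σ₋₁[2^α*n/4]-4σ₋₁[2^α*n/2]+8σ₋₁[n] zero {n} 2∤n = trans
  (cong₂ (λ a b → ⟦ 8 ⟧ * a - ⟦ 4 ⟧ * b + ⟦ 8 ⟧ * σ₋₁ n)
     (σ₋₁[h/k]≡0 4 (2∤1*n ∘ ∣-trans (divides 2 refl))) (σ₋₁[h/k]≡0 2 2∤1*n))
  (solve 1 (λ X → con ⟦ 8 ⟧ :* con 0ℚ :- con ⟦ 4 ⟧ :* con 0ℚ :+ con ⟦ 8 ⟧ :* X
               := con ⟦ 8 ⟧ :* con 1ℚ :* X :* con 1ℚ) refl (σ₋₁ n))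
  where
  2∤1*n : ¬ 2 ∣ 1 ℕ.* n
  2∤1*n = 2∤n ∘ subst (2 ∣_) (ℕP.*-identityˡ n)
8σ₋₁[2^α*n/4]-4σ₋₁[2^α*n/2]+8σ₋₁[n] (suc zero) {n} 2∤n = trans
  (cong₂ (λ a b → ⟦ 8 ⟧ * a - ⟦ 4 ⟧ * b + ⟦ 8 ⟧ * σ₋₁ n)
     (σ₋₁[h/k]≡0 4 (2∤n ∘ *-cancelˡ-∣ 2)) (σ₋₁[q*k/k] 2 n (ℕP.*-comm 2 n)))
  (solve 1 (λ X → con ⟦ 8 ⟧ :* con 0ℚ :- con ⟦ 4 ⟧ :* X :+ con ⟦ 8 ⟧ :* X
               := con ⟦ 8 ⟧ :* con (recip 2) :* X :* con 1ℚ) refl (σ₋₁ n))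
8σ₋₁[2^α*n/4]-4σ₋₁[2^α*n/2]+8σ₋₁[n] α@(suc (suc k)) {n} 2∤n = begin
  ⟦ 8 ⟧ * σ₋₁[ 2 ^ α ℕ.* n / 4 ] - ⟦ 4 ⟧ * σ₋₁[ 2 ^ α ℕ.* n / 2 ] + ⟦ 8 ⟧ * X
    ≡⟨ cong₂ (λ a b → ⟦ 8 ⟧ * a - ⟦ 4 ⟧ * b + ⟦ 8 ⟧ * X) σ₋₁[h/4] σ₋₁[h/2] ⟩
  ⟦ 8 ⟧ * ((⟦ 2 ⟧ - r) * X) - ⟦ 4 ⟧ * ((⟦ 2 ⟧ - recip 2 * r) * X) + ⟦ 8 ⟧ * X
    ≡⟨ solve 2 (λ X r → con ⟦ 8 ⟧ :* ((con ⟦ 2 ⟧ :- r) :* X) :- con ⟦ 4 ⟧ :* ((con ⟦ 2 ⟧ :- con (recip 2) :* r) :* X)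
                          :+ con ⟦ 8 ⟧ :* X
                      := (con ⟦ 16 ⟧ :* con 1ℚ :- con ⟦ 6 ⟧ :* r) :* X) refl X r ⟩
  (⟦ 16 ⟧ * 1ℚ - ⟦ 6 ⟧ * r) * X
    ≡⟨ cong (λ t → (⟦ 16 ⟧ * t - ⟦ 6 ⟧ * r) * X) (sym (recip-inverseˡ (2 ^ k))) ⟩
  (⟦ 16 ⟧ * (r * P) - ⟦ 6 ⟧ * r) * X
    ≡⟨ solve 3 (λ X r P → (con ⟦ 16 ⟧ :* (r :* P) :- con ⟦ 6 ⟧ :* r) :* X
                        := con ⟦ 8 ⟧ :* (con (recip 2) :* (con (recip 2) :* r)) :* X :* (con ⟦ 8 ⟧ :* P :- con ⟦ 3 ⟧))
               refl X r P ⟩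
  ⟦ 8 ⟧ * (recip 2 * (recip 2 * r)) * X * (⟦ 8 ⟧ * P - ⟦ 3 ⟧)
    ≡⟨ sym (cong₂ (λ a b → ⟦ 8 ⟧ * a * X * b) recip[2^α] (∣⟦2^[k+3]⟧-⟦3⟧∣ k)) ⟩
  ⟦ 8 ⟧ * recip (2 ^ α) * X * ∣ ⟦ 2 ^ (α ℕ.+ 1) ⟧ - ⟦ 3 ⟧ ∣
    ∎
  where
  instance _ = ℕP.m^n≢0 2 k
  X = σ₋₁ n
  r = recip (2 ^ k)
  P = ⟦ 2 ^ k ⟧
  σ₋₁[h/4] : σ₋₁[ 2 ^ α ℕ.* n / 4 ] ≡ (⟦ 2 ⟧ - r) * X
  σ₋₁[h/4] = trans (σ₋₁[q*k/k] 4 (2 ^ k ℕ.* n) (rearrange (2 ^ k) n)) (σ₋₁[2^k*n] k 2∤n)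
    where
    rearrange : ∀ p m → 2 ℕ.* (2 ℕ.* p) ℕ.* m ≡ p ℕ.* m ℕ.* 4
    rearrange = solve-∀
  σ₋₁[h/2] : σ₋₁[ 2 ^ α ℕ.* n / 2 ] ≡ (⟦ 2 ⟧ - recip 2 * r) * X
  σ₋₁[h/2] = begin
    σ₋₁[ 2 ^ α ℕ.* n / 2 ]           ≡⟨ σ₋₁[q*k/k] 2 (2 ^ suc k ℕ.* n) (rearrange (2 ^ suc k) n) ⟩
    σ₋₁ (2 ^ suc k ℕ.* n)            ≡⟨ σ₋₁[2^k*n] (suc k) 2∤n ⟩
    (⟦ 2 ⟧ - recip (2 ^ suc k)) * X  ≡⟨ cong (λ s → (⟦ 2 ⟧ - s) * X) (recip-* 2 (2 ^ k)) ⟩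
    (⟦ 2 ⟧ - recip 2 * r) * X        ∎
    where
    rearrange : ∀ p m → 2 ℕ.* p ℕ.* m ≡ p ℕ.* m ℕ.* 2
    rearrange = solve-∀
  recip[2^α] : recip (2 ^ α) ≡ recip 2 * (recip 2 * r)
  recip[2^α] = trans (recip-* 2 (2 ^ suc k)) (cong (recip 2 *_) (recip-* 2 (2 ^ k)))

lemma7p2 : (h α h′ : ℕ) → 1 ≤ h → h ≡ 2 ^ α ℕ.* h′ → ¬ (2 ∣ h′) →
    ⟦ 4 ⟧ * (π²φ∞ h + π²φ₀ h)
      ≡ (⟦ 8 ℕ.* σ₁ h′ ⟧ * recip h) * ∣ ⟦ 2 ^ (α ℕ.+ 1) ⟧ - ⟦ 3 ⟧ ∣
lemma7p2 _ α zero      _ _    2∤0  = contradiction (2 ∣0) 2∤0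
lemma7p2 _ α h′@(suc _) _ refl 2∤h′ = begin
  ⟦ 4 ⟧ * (π²φ∞ h + π²φ₀ h)                                       ≡⟨ 4[π²φ∞+π²φ₀] h ⟩
  ⟦ 8 ⟧ * σ₋₁[ h / 4 ] - ⟦ 4 ⟧ * σ₋₁[ h / 2 ] + ⟦ 8 ⟧ * σ⁽²⁾₋₁ h  ≡⟨ cong (λ s → ⟦ 8 ⟧ * σ₋₁[ h / 4 ] - ⟦ 4 ⟧ * σ₋₁[ h / 2 ] + ⟦ 8 ⟧ * s)
                                                                             (σ⁽²⁾₋₁[2^k*n] α 2∤h′) ⟩
  ⟦ 8 ⟧ * σ₋₁[ h / 4 ] - ⟦ 4 ⟧ * σ₋₁[ h / 2 ] + ⟦ 8 ⟧ * σ₋₁ h′   ≡⟨ 8σ₋₁[2^α*n/4]-4σ₋₁[2^α*n/2]+8σ₋₁[n] α 2∤h′ ⟩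
  ⟦ 8 ⟧ * recip (2 ^ α) * σ₋₁ h′ * w                              ≡⟨ cong (_* w) (sym (⟦c*σ₁n⟧*recip[j*n] 8 (2 ^ α) h′)) ⟩
  (⟦ 8 ℕ.* σ₁ h′ ⟧ * recip h) * w                                 ∎
  where
  h = 2 ^ α ℕ.* h′
  w = ∣ ⟦ 2 ^ (α ℕ.+ 1) ⟧ - ⟦ 3 ⟧ ∣
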